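{- Let $G$ be a connected graph of order $n$ and $H$ a graph with $k\ge1$ connected components $H_1,\dots,H_k$, each of order $m_i\ge2$. Let $Z$ be a minimum zero forcing set of $G\circ H$ and, for each $i$, let $Z_i=Z\cap (V(G)\times V(H_i))$. Then $P_G(Z_i)=V(G)$ for each $i$, where $P_G(S)=\{a\in V(G):(a,v)\in S\text{ for some }v\}$.
   Context: Graphs are finite, simple, undirected, with at least two vertices. Zero forcing: given a set $S$ of initially black vertices (others white), the color-change rule turns a white vertex black if it is the only white neighbor of some black vertex; $S$ is a zero forcing set if eventually all vertices become black. The lexicographic product $G\circ H$ has vertex set $V(G)\times V(H)$, with $(a,v)$ adjacent to $(b,w)$ iff $ab\in E(G)$, or $a=b$ and $vw\in E(H)$. -}

module Defs where

open import Data.Nat using (ℕ; _*_; _≤_)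
open import Data.Fin using (Fin; remQuot)
open import Data.Fin.Subset using (Subset; _∈_; ∣_∣)
open import Data.Product using (_×_; _,_; proj₁; proj₂)
open import Data.Sum using (_⊎_; inj₁; inj₂)
open import Data.Empty using (⊥)
open import Relation.Nullary using (¬_)
open import Relation.Binary.PropositionalEquality using (_≡_; refl; _≢_)

record Graph : Set₁ where
  field
    order  : ℕ
    Adj    : Fin order → Fin order → Set
    sym    : ∀ {x y} → Adj x y → Adj y x
    irrefl : ∀ {x} → ¬ Adj x x
open Graph public

data Reach (G : Graph) : Fin (order G) → Fin (order G) → Set where
  here : ∀ {x} → Reach G x x
  step : ∀ {x y z} → Adj G x y → Reach G y z → Reach G x z

Connected : Graph → Set
Connected G = ∀ a b → Reach G a b

-- Lexicographic product G ∘ H. Vertex set V(G) × V(H) is encoded as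
-- Fin (order G * order H), decoded by remQuot into (a , v).
pairAdj : (G H : Graph) → Fin (order G) × Fin (order H) → Fin (order G) × Fin (order H) → Set
pairAdj G H (a , v) (b , w) = Adj G a b ⊎ (a ≡ b × Adj H v w)

pairSym : (G H : Graph) → ∀ p q → pairAdj G H p q → pairAdj G H q p
pairSym G H (a , v) (b , w) (inj₁ r) = inj₁ (Graph.sym G r)
pairSym G H (a , v) (.a , w) (inj₂ (refl , r)) = inj₂ (refl , Graph.sym H r)

pairIrrefl : (G H : Graph) → ∀ p → ¬ pairAdj G H p p
pairIrrefl G H (a , v) (inj₁ r) = Graph.irrefl G r
pairIrrefl G H (a , v) (inj₂ (_ , r)) = Graph.irrefl H r

lexAdj : (G H : Graph) → Fin (order G * order H) → Fin (order G * order H) → Set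
lexAdj G H x y = pairAdj G H (remQuot (order H) x) (remQuot (order H) y)

_∘ₗ_ : Graph → Graph → Graph
G ∘ₗ H = record
  { order = order G * order H
  ; Adj = lexAdj G H
  ; sym = λ {x} {y} → pairSym G H (remQuot (order H) x) (remQuot (order H) y)
  ; irrefl = λ {x} → pairIrrefl G H (remQuot (order H) x) }

-- Zero forcing: the set of vertices that eventually become black when
-- starting from S and applying the color-change rule (least closed set).
data Forced (G : Graph) (S : Subset (order G)) : Fin (order G) → Set where
  init  : ∀ {x} → x ∈ S → Forced G S x
  force : ∀ {u x} → Forced G S u → Adj G u x
        → (∀ w → Adj G u w → w ≢ x → Forced G S w)
        → Forced G S x

IsZeroForcingSet : (G : Graph) → Subset (order G) → Set
IsZeroForcingSet G S = ∀ x → Forced G S x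

IsMinimumZeroForcingSet : (G : Graph) → Subset (order G) → Set
IsMinimumZeroForcingSet G Z =
  IsZeroForcingSet G Z × (∀ Z′ → IsZeroForcingSet G Z′ → ∣ Z ∣ ≤ ∣ Z′ ∣)

-- If the fibre {a} × C over a component C of H contains no vertex of S, no vertex of
-- it is ever forced. A forcer outside the fibre is G-adjacent to a, hence adjacent to
-- (a , w) for every w ∈ C; since |C| ≥ 2 it has at least two white neighbours there.
-- A forcer inside the fibre is itself a vertex of the fibre, hence white.
module Submission where

open import Defs
open import Data.Nat using (_≤_)
open import Data.Fin using (Fin; combine; remQuot)
open import Data.Fin.Properties using (remQuot-combine; combine-remQuot)
open import Data.Fin.Subset using (Subset; _∈_)
open import Data.Product using (_×_; ∃-syntax; _,_; proj₁; proj₂)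
open import Data.Sum using (inj₁; inj₂)
open import Relation.Binary.PropositionalEquality
  using (_≡_; _≢_; cong; subst; subst₂; trans) renaming (sym to ≡-sym)

Reach-trans : ∀ {H : Graph} {x y z} → Reach H x y → Reach H y z → Reach H x z
Reach-trans here       r′ = r′
Reach-trans (step e r) r′ = step e (Reach-trans r r′)

module Lexicographic (G H : Graph) where

  row : Fin (order (G ∘ₗ H)) → Fin (order G)
  row x = proj₁ (remQuot {order G} (order H) x)

  col : Fin (order (G ∘ₗ H)) → Fin (order H)
  col x = proj₂ (remQuot {order G} (order H) x)

  row-combine : ∀ a w → row (combine a w) ≡ a
  row-combine a w = cong proj₁ (remQuot-combine {order G} {order H} a w)

  col-combine : ∀ a w → col (combine a w) ≡ w
  col-combine a w = cong proj₂ (remQuot-combine {order G} {order H} a w)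

  combine-row-col : ∀ x → combine (row x) (col x) ≡ x
  combine-row-col x = combine-remQuot {order G} (order H) x

  -- S meets the fibre {a} × C, where C is the component of H containing v.
  SeedsFibre : Subset (order (G ∘ₗ H)) → Fin (order G) → Fin (order H) → Set
  SeedsFibre S a v = ∃[ w ] (Reach H v w × combine a w ∈ S)

  SeedsFibre-reach : ∀ {S a v v′} → Reach H v v′ → SeedsFibre S a v′ → SeedsFibre S a v
  SeedsFibre-reach r (w , r′ , w∈S) = w , Reach-trans r r′ , w∈S

  SeedsFibre-combine : ∀ {S a w} → SeedsFibre S (row (combine a w)) (col (combine a w))
                     → SeedsFibre S a w
  SeedsFibre-combine {S} {a} {w} = subst₂ (SeedsFibre S) (row-combine a w) (col-combine a w)

  module _ (nontrivial : ∀ v → ∃[ w ] (w ≢ v × Reach H v w))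
           {S : Subset (order (G ∘ₗ H))} where

    forced⇒SeedsFibre : ∀ {x} → Forced (G ∘ₗ H) S x → SeedsFibre S (row x) (col x)
    forced⇒SeedsFibre {x} (init x∈S) =
      col x , here , subst (_∈ S) (≡-sym (combine-row-col x)) x∈S
    forced⇒SeedsFibre {x} (force u-forced (inj₂ (row-u≡row-x , col-u~col-x)) _) =
      subst (λ a → SeedsFibre S a (col x)) row-u≡row-x
        (SeedsFibre-reach (step (Graph.sym H col-u~col-x) here) (forced⇒SeedsFibre u-forced))
    forced⇒SeedsFibre {x} (force {u} _ (inj₁ row-u~row-x) othersForced) =
      SeedsFibre-reach col-x⇝w
        (SeedsFibre-combine (forced⇒SeedsFibre (othersForced y u~y y≢x)))
      where
        w = proj₁ (nontrivial (col x))
        w≢col-x = proj₁ (proj₂ (nontrivial (col x)))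
        col-x⇝w = proj₂ (proj₂ (nontrivial (col x)))
        y = combine (row x) w
        u~y : Adj (G ∘ₗ H) u y
        u~y = subst (pairAdj G H (remQuot {order G} (order H) u))
                    (≡-sym (remQuot-combine {order G} {order H} (row x) w)) (inj₁ row-u~row-x)
        y≢x : y ≢ x
        y≢x y≡x = w≢col-x (trans (≡-sym (col-combine (row x) w)) (cong col y≡x))

    zeroForcing⇒SeedsFibre : IsZeroForcingSet (G ∘ₗ H) S → ∀ a v → SeedsFibre S a v
    zeroForcing⇒SeedsFibre zf a v = SeedsFibre-combine (forced⇒SeedsFibre (zf (combine a v)))

mainTheorem17 : (G H : Graph) → 2 ≤ order G → 2 ≤ order H → Connected G
    → (∀ v → ∃[ w ] (w ≢ v × Reach H v w))
    → (Z : Subset (order (G ∘ₗ H))) → IsMinimumZeroForcingSet (G ∘ₗ H) Z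
    → ∀ (v : Fin (order H)) (a : Fin (order G))
    → ∃[ w ] (Reach H v w × combine a w ∈ Z)
mainTheorem17 G H _ _ _ nontrivial Z (zf , _) v a =
  Lexicographic.zeroForcing⇒SeedsFibre G H nontrivial zf a v
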